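{- For every positive integer $n$, $\chi_{ld}(F_n+B_{n,n})=2n+5$.
   Context: For a graph $G=(V,E)$ of order $N$ and a bijection $f\colon V\to\{1,\dots,N\}$, the weight of a vertex $u$ is $w(u)=\sum_{x\in N(u)}f(x)$, where $N(u)$ is the open neighborhood of $u$. The bijection $f$ is a local distance antimagic labeling if $w(u)\neq w(v)$ for every edge $uv$. $\chi_{ld}(G)$ is the minimum number of distinct weights over all local distance antimagic labelings of $G$. The friendship graph $F_n$ consists of $n$ copies of $K_2$ all joined to a single central vertex (order $2n+1$). The bistar $B_{n,n}$ has two adjacent vertices $a,b$, with $n$ pendant vertices $x_1,\dots,x_n$ adjacent to $a$ and $n$ pendant vertices $y_1,\dots,y_n$ adjacent to $b$. $G+H$ is the join of $G$ and $H$ (disjoint union plus all edges between $V(G)$ and $V(H)$). -}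

module Defs where

open import Data.Nat using (ℕ; zero; suc; _+_; _≤_)
open import Data.Nat.Properties using () renaming (_≟_ to _≟ℕ_)
open import Data.Fin using (Fin; zero; suc; toℕ; splitAt)
open import Data.Fin.Properties using (_≟_)
open import Data.Bool using (Bool; true; false; if_then_else_; _∧_)
open import Data.Sum using (_⊎_; inj₁; inj₂)
open import Data.List using (List; map; length; allFin; deduplicate)
open import Data.Nat.ListAction using (sum)
open import Data.Product using (Σ; _×_; _,_)
open import Relation.Nullary using (¬_)
open import Relation.Nullary.Decidable using (⌊_⌋)
open import Relation.Binary.PropositionalEquality using (_≡_)
open import Function.Bundles using (_⤖_; Bijection)

record Graph : Set where
  field
    order : ℕ
    adj   : Fin order → Fin order → Bool
open Graph public

-- A labeling is a bijection V → {1,…,N}; we represent it as a bijection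
-- Fin N ⤖ Fin N, the label of x being 1 + toℕ (f x).
Labeling : Graph → Set
Labeling G = Fin (order G) ⤖ Fin (order G)

label : (G : Graph) → Labeling G → Fin (order G) → ℕ
label G f x = suc (toℕ (Bijection.to f x))

weight : (G : Graph) → Labeling G → Fin (order G) → ℕ
weight G f u = sum (map (λ x → if adj G u x then label G f x else 0) (allFin (order G)))

IsLDA : (G : Graph) → Labeling G → Set
IsLDA G f = ∀ u v → adj G u v ≡ true → ¬ (weight G f u ≡ weight G f v)

numWeights : (G : Graph) → Labeling G → ℕ
numWeights G f = length (deduplicate _≟ℕ_ (map (weight G f) (allFin (order G))))

ChiLd≡ : Graph → ℕ → Set
ChiLd≡ G k =
  (Σ (Labeling G) λ f → IsLDA G f × numWeights G f ≡ k)
  × (∀ (f : Labeling G) → IsLDA G f → k ≤ numWeights G f)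

join : Graph → Graph → Graph
join G H = record { order = order G + order H ; adj = a }
  where
  a : Fin (order G + order H) → Fin (order G + order H) → Bool
  a i j with splitAt (order G) i | splitAt (order G) j
  ... | inj₁ p | inj₁ q = adj G p q
  ... | inj₂ p | inj₂ q = adj H p q
  ... | inj₁ _ | inj₂ _ = true
  ... | inj₂ _ | inj₁ _ = true

-- Friendship graph F_n on Fin (1 + (n + n)):
-- zero = centre; suc i with splitAt n i = inj₁ j is u_j, inj₂ j is v_j; edges u_j v_j.
friendship : ℕ → Graph
friendship n = record { order = suc (n + n) ; adj = a }
  where
  leaf : Fin (n + n) → Fin (n + n) → Bool
  leaf i j with splitAt n i | splitAt n j
  ... | inj₁ p | inj₂ q = ⌊ p ≟ q ⌋
  ... | inj₂ p | inj₁ q = ⌊ p ≟ q ⌋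
  ... | _ | _ = false
  a : Fin (suc (n + n)) → Fin (suc (n + n)) → Bool
  a zero zero = false
  a zero (suc _) = true
  a (suc _) zero = true
  a (suc i) (suc j) = leaf i j

-- Bistar B_{n,n} on Fin (2 + (n + n)):
-- 0 = a, 1 = b; 2 + i with splitAt n i = inj₁ j is x_j (adjacent to a),
-- inj₂ j is y_j (adjacent to b); and a ~ b.
bistar : ℕ → Graph
bistar n = record { order = suc (suc (n + n)) ; adj = a }
  where
  isX : Fin (n + n) → Bool
  isX i with splitAt n i
  ... | inj₁ _ = true
  ... | inj₂ _ = false
  isY : Fin (n + n) → Bool
  isY i with splitAt n i
  ... | inj₁ _ = false
  ... | inj₂ _ = true
  a : Fin (suc (suc (n + n))) → Fin (suc (suc (n + n))) → Bool
  a zero zero = false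
  a zero (suc zero) = true
  a (suc zero) zero = true
  a (suc zero) (suc zero) = false
  a zero (suc (suc i)) = isX i
  a (suc (suc i)) zero = isX i
  a (suc zero) (suc (suc i)) = isY i
  a (suc (suc i)) (suc zero) = isY i
  a (suc (suc _)) (suc (suc _)) = false

{-# OPTIONS --safe #-}

-- In F_n + B_{n,n} each side is completely joined to the other, so the weight of
-- a vertex is its neighbour sum within its own side plus the total label of the
-- other side.  Hence all x-leaves share one weight and all y-leaves another.
-- Under a local distance antimagic labeling the remaining weights are forced
-- apart: the 2n + 1 friendship vertices get pairwise distinct weights (the
-- centre is adjacent to every leaf, and a leaf's weight f(centre) + f(mate)
-- determines the leaf), a, b, an x-leaf and a y-leaf get four more, and vertices
-- on opposite sides are adjacent.  So every such labeling has exactly 2n + 5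
-- weights, and it remains to exhibit one: giving the friendship side the
-- smallest labels puts every friendship weight above every bistar weight.
module Submission where

open import Defs
open import Data.Bool using (true; false; if_then_else_)
open import Data.Empty using (⊥-elim)
open import Data.Fin using (Fin; zero; suc; toℕ; fromℕ<; splitAt; _↑ˡ_; _↑ʳ_)
open import Data.Fin.Permutation using (transpose)
import Data.Fin.Permutation.Components as PC
open import Data.Fin.Properties
  using (toℕ-injective; toℕ<n; toℕ-↑ˡ; toℕ-↑ʳ; ↑ˡ-injective; ↑ʳ-injective;
         splitAt-↑ˡ; splitAt-↑ʳ; splitAt⁻¹-↑ˡ; splitAt⁻¹-↑ʳ)
  renaming (_≟_ to _≟ᶠ_; suc-injective to suc-injectiveᶠ)
open import Data.List using (List; _∷_; map; tabulate; allFin; length; deduplicate)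
open import Data.List.Membership.Propositional using (_∈_)
open import Data.List.Membership.Propositional.Properties
  using (∈-map⁺; ∈-map⁻; ∈-tabulate⁺; ∈-allFin; deduplicate-∈⇔)
open import Data.List.Membership.Propositional.Properties.WithK using (unique∧set⇒bag)
open import Data.List.Properties using (map-tabulate; length-map; length-tabulate)
open import Data.List.Relation.Binary.BagAndSetEquality using (∼bag⇒↭)
open import Data.List.Relation.Binary.Permutation.Propositional.Properties using (↭-length)
open import Data.List.Relation.Unary.All using (All; _∷_)
import Data.List.Relation.Unary.All.Properties as All
open import Data.List.Relation.Unary.AllPairs using (AllPairs; _∷_)
import Data.List.Relation.Unary.AllPairs.Properties as AllPairs
open import Data.List.Relation.Unary.Any using (here; there)
open import Data.List.Relation.Unary.Unique.DecPropositional.Properties using (deduplicate-!)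
open import Data.Nat using (ℕ; zero; suc; _+_; _*_; _≤_; _<_; s≤s; z≤n)
open import Data.Nat.ListAction using (sum)
open import Data.Nat.Properties
open import Data.Nat.Tactic.RingSolver using (solve-∀)
open import Data.Product using (_,_)
open import Data.Sum using (_⊎_; inj₁; inj₂; [_,_])
open import Function using (_∘_; _$_; id; case_of_)
open import Function.Bundles using (Bijection; _⇔_; mk⇔; Equivalence)
open import Function.Properties.Inverse using (↔⇒⤖)
open import Relation.Binary.PropositionalEquality
  using (_≡_; _≢_; refl; sym; trans; cong; cong₂; subst; ≢-sym; module ≡-Reasoning)
open import Relation.Nullary.Decidable using (⌊_⌋; yes; no; dec-true; dec-false)

open import Algebra.Properties.CommutativeMonoid.Sum +-0-commutativeMonoid
  using (sum-cong-≗; sum-replicate-zero; ∑-distrib-+) renaming (sum to ∑)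

data SplitView (m : ℕ) {k : ℕ} : Fin (m + k) → Set where
  left  : (i : Fin m) → SplitView m (i ↑ˡ k)
  right : (j : Fin k) → SplitView m (m ↑ʳ j)

splitView : ∀ m {k} (i : Fin (m + k)) → SplitView m i
splitView m i with splitAt m i in eq
... | inj₁ p = subst (SplitView m) (splitAt⁻¹-↑ˡ eq) (left p)
... | inj₂ q = subst (SplitView m) (splitAt⁻¹-↑ʳ eq) (right q)

transpose-≢ : ∀ {m} {i j k : Fin m} → k ≢ i → k ≢ j → PC.transpose i j k ≡ k
transpose-≢ {i = i} {j} {k} k≢i k≢j rewrite dec-false (k ≟ᶠ i) k≢i | dec-false (k ≟ᶠ j) k≢j = refl

transpose-i≡j : ∀ {m} {i j : Fin m} → PC.transpose i j i ≡ j
transpose-i≡j {i = i} rewrite dec-true (i ≟ᶠ i) refl = refl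

transpose-j≡i : ∀ {m} {i j : Fin m} → j ≢ i → PC.transpose i j j ≡ i
transpose-j≡i {i = i} {j} j≢i rewrite dec-false (j ≟ᶠ i) j≢i | dec-true (j ≟ᶠ j) refl = refl

↑ˡ≢↑ʳ : ∀ {m k} (i : Fin m) (j : Fin k) → i ↑ˡ k ≢ m ↑ʳ j
↑ˡ≢↑ʳ {m} {k} i j eq with trans (sym (splitAt-↑ˡ m i k)) (trans (cong (splitAt m) eq) (splitAt-↑ʳ m k j))
... | ()

sum-map-allFin : ∀ {m} (g : Fin m → ℕ) → sum (map g (allFin m)) ≡ ∑ g
sum-map-allFin g = trans (cong sum (map-tabulate id g)) (sum-tabulate g)
  where
  sum-tabulate : ∀ {m} (g : Fin m → ℕ) → sum (tabulate g) ≡ ∑ g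
  sum-tabulate {zero}  g = refl
  sum-tabulate {suc m} g = cong (g zero +_) (sum-tabulate (g ∘ suc))

∑-↑ˡ-↑ʳ : ∀ m {k} (g : Fin (m + k) → ℕ) → ∑ g ≡ ∑ (g ∘ (_↑ˡ k)) + ∑ (g ∘ (m ↑ʳ_))
∑-↑ˡ-↑ʳ zero    g = refl
∑-↑ˡ-↑ʳ (suc m) g = trans (cong (g zero +_) (∑-↑ˡ-↑ʳ m (g ∘ suc))) (sym (+-assoc (g zero) _ _))

∑-zero : ∀ {m} {g : Fin m → ℕ} → (∀ i → g i ≡ 0) → ∑ g ≡ 0
∑-zero {m} g≗0 = trans (sum-cong-≗ g≗0) (sum-replicate-zero m)

∑-indicator : ∀ {m} (j : Fin m) (g : Fin m → ℕ) → ∑ (λ i → if ⌊ j ≟ᶠ i ⌋ then g i else 0) ≡ g j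
∑-indicator {suc m} zero    g = trans (cong (g zero +_) (∑-zero {m} λ _ → refl)) (+-identityʳ (g zero))
∑-indicator {suc m} (suc j) g =
  trans (sum-cong-≗ λ i → cong (if_then g (suc i) else 0) (⌊suc≟suc⌋ i)) (∑-indicator j (g ∘ suc))
  where
  -- ⌊_⌋ is isYes, which does not compute through the map′ in suc j ≟ᶠ suc i.
  ⌊suc≟suc⌋ : ∀ i → ⌊ suc j ≟ᶠ suc i ⌋ ≡ ⌊ j ≟ᶠ i ⌋
  ⌊suc≟suc⌋ i with j ≟ᶠ i
  ... | yes _ = refl
  ... | no _  = refl

≤-∑ : ∀ {m} (g : Fin m → ℕ) (i : Fin m) → g i ≤ ∑ g
≤-∑ g zero    = m≤m+n (g zero) _
≤-∑ g (suc i) = ≤-trans (≤-∑ (g ∘ suc) i) (m≤n+m _ (g zero))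

∑-mono-≤ : ∀ {m} {g h : Fin m → ℕ} → (∀ i → g i ≤ h i) → ∑ g ≤ ∑ h
∑-mono-≤ {zero}  g≤h = ≤-refl
∑-mono-≤ {suc m} g≤h = +-mono-≤ (g≤h zero) (∑-mono-≤ (g≤h ∘ suc))

neighbourSum : (G : Graph) → (Fin (order G) → ℕ) → Fin (order G) → ℕ
neighbourSum G g u = ∑ λ x → if adj G u x then g x else 0

ProperNeighbourSums : (G : Graph) → (Fin (order G) → ℕ) → Set
ProperNeighbourSums G g = ∀ p q → adj G p q ≡ true → neighbourSum G g p ≢ neighbourSum G g q

weight≡neighbourSum : (G : Graph) (f : Labeling G) (u : Fin (order G)) →
                      weight G f u ≡ neighbourSum G (label G f) u
weight≡neighbourSum G f u = sum-map-allFin λ x → if adj G u x then label G f x else 0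

label-injective : (G : Graph) (f : Labeling G) {x y : Fin (order G)} →
                  label G f x ≡ label G f y → x ≡ y
label-injective G f eq = Bijection.injective f (toℕ-injective (suc-injective eq))

numWeights≡length : (G : Graph) (f : Labeling G) (zs : List (Fin (order G))) →
  AllPairs (λ z z′ → weight G f z ≢ weight G f z′) zs →
  (∀ z → weight G f z ∈ map (weight G f) zs) →
  numWeights G f ≡ length zs
numWeights≡length G f zs distinct attained = begin
  length (deduplicate _≟_ ws)
    ≡⟨ ↭-length (∼bag⇒↭ (unique∧set⇒bag (deduplicate-! _≟_ ws) (AllPairs.map⁺ distinct) sameSet)) ⟩
  length (map w zs)
    ≡⟨ length-map w zs ⟩
  length zs
    ∎
  where
  open ≡-Reasoning
  w = weight G f
  ws = map w (allFin (order G))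
  sameSet : ∀ {y} → y ∈ deduplicate _≟_ ws ⇔ y ∈ map w zs
  sameSet = mk⇔ (attained′ ∘ Equivalence.from (deduplicate-∈⇔ _≟_))
                (Equivalence.to (deduplicate-∈⇔ _≟_) ∘ isWeight)
    where
    attained′ : ∀ {y} → y ∈ ws → y ∈ map w zs
    attained′ y∈ws with ∈-map⁻ w y∈ws
    ... | z , _ , refl = attained z
    isWeight : ∀ {y} → y ∈ map w zs → y ∈ ws
    isWeight y∈ with ∈-map⁻ w y∈
    ... | z , _ , refl = ∈-map⁺ w (∈-allFin z)

module _ (G H : Graph) where

  private
    m = order G
    k = order H

  adj-join-↑ˡ-↑ˡ : ∀ p q → adj (join G H) (p ↑ˡ k) (q ↑ˡ k) ≡ adj G p q
  adj-join-↑ˡ-↑ˡ p q rewrite splitAt-↑ˡ m p k | splitAt-↑ˡ m q k = refl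

  adj-join-↑ˡ-↑ʳ : ∀ p q → adj (join G H) (p ↑ˡ k) (m ↑ʳ q) ≡ true
  adj-join-↑ˡ-↑ʳ p q rewrite splitAt-↑ˡ m p k | splitAt-↑ʳ m k q = refl

  adj-join-↑ʳ-↑ˡ : ∀ q p → adj (join G H) (m ↑ʳ q) (p ↑ˡ k) ≡ true
  adj-join-↑ʳ-↑ˡ q p rewrite splitAt-↑ˡ m p k | splitAt-↑ʳ m k q = refl

  adj-join-↑ʳ-↑ʳ : ∀ p q → adj (join G H) (m ↑ʳ p) (m ↑ʳ q) ≡ adj H p q
  adj-join-↑ʳ-↑ʳ p q rewrite splitAt-↑ʳ m k p | splitAt-↑ʳ m k q = refl

  private
    row : (Fin (m + k) → ℕ) → Fin (m + k) → Fin (m + k) → ℕ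
    row g z x = if adj (join G H) z x then g x else 0

  neighbourSum-join-↑ˡ : (g : Fin (m + k) → ℕ) (p : Fin m) →
    neighbourSum (join G H) g (p ↑ˡ k) ≡ neighbourSum G (g ∘ (_↑ˡ k)) p + ∑ (g ∘ (m ↑ʳ_))
  neighbourSum-join-↑ˡ g p = begin
    neighbourSum (join G H) g (p ↑ˡ k)
      ≡⟨ ∑-↑ˡ-↑ʳ m (row g (p ↑ˡ k)) ⟩
    ∑ (row g (p ↑ˡ k) ∘ (_↑ˡ k)) + ∑ (row g (p ↑ˡ k) ∘ (m ↑ʳ_))
      ≡⟨ cong₂ _+_ (sum-cong-≗ λ q → cong (if_then g (q ↑ˡ k) else 0) (adj-join-↑ˡ-↑ˡ p q))
                   (sum-cong-≗ λ q → cong (if_then g (m ↑ʳ q) else 0) (adj-join-↑ˡ-↑ʳ p q)) ⟩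
    neighbourSum G (g ∘ (_↑ˡ k)) p + ∑ (g ∘ (m ↑ʳ_))
      ∎
    where open ≡-Reasoning

  neighbourSum-join-↑ʳ : (g : Fin (m + k) → ℕ) (q : Fin k) →
    neighbourSum (join G H) g (m ↑ʳ q) ≡ ∑ (g ∘ (_↑ˡ k)) + neighbourSum H (g ∘ (m ↑ʳ_)) q
  neighbourSum-join-↑ʳ g q = begin
    neighbourSum (join G H) g (m ↑ʳ q)
      ≡⟨ ∑-↑ˡ-↑ʳ m (row g (m ↑ʳ q)) ⟩
    ∑ (row g (m ↑ʳ q) ∘ (_↑ˡ k)) + ∑ (row g (m ↑ʳ q) ∘ (m ↑ʳ_))
      ≡⟨ cong₂ _+_ (sum-cong-≗ λ p → cong (if_then g (p ↑ˡ k) else 0) (adj-join-↑ʳ-↑ˡ q p))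
                   (sum-cong-≗ λ p → cong (if_then g (m ↑ʳ p) else 0) (adj-join-↑ʳ-↑ʳ q p)) ⟩
    ∑ (g ∘ (_↑ˡ k)) + neighbourSum H (g ∘ (m ↑ʳ_)) q
      ∎
    where open ≡-Reasoning

module JoinLabeling (G H : Graph) (f : Labeling (join G H)) where

  private
    m = order G
    k = order H

  w : Fin (m + k) → ℕ
  w = weight (join G H) f

  labelˡ : Fin m → ℕ
  labelˡ = label (join G H) f ∘ (_↑ˡ k)

  labelʳ : Fin k → ℕ
  labelʳ = label (join G H) f ∘ (m ↑ʳ_)

  labelˡ-injective : ∀ {p q} → labelˡ p ≡ labelˡ q → p ≡ q
  labelˡ-injective = ↑ˡ-injective k _ _ ∘ label-injective (join G H) f

  labelʳ-injective : ∀ {p q} → labelʳ p ≡ labelʳ q → p ≡ q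
  labelʳ-injective = ↑ʳ-injective m _ _ ∘ label-injective (join G H) f

  0<labelˡ : ∀ p → 0 < labelˡ p
  0<labelˡ _ = s≤s z≤n

  0<labelʳ : ∀ q → 0 < labelʳ q
  0<labelʳ _ = s≤s z≤n

  weight-↑ˡ : ∀ p → w (p ↑ˡ k) ≡ neighbourSum G labelˡ p + ∑ labelʳ
  weight-↑ˡ p = trans (weight≡neighbourSum (join G H) f (p ↑ˡ k)) (neighbourSum-join-↑ˡ G H _ p)

  weight-↑ʳ : ∀ q → w (m ↑ʳ q) ≡ ∑ labelˡ + neighbourSum H labelʳ q
  weight-↑ʳ q = trans (weight≡neighbourSum (join G H) f (m ↑ʳ q)) (neighbourSum-join-↑ʳ G H _ q)

  weight-↑ˡ-cancel : ∀ {p q} → w (p ↑ˡ k) ≡ w (q ↑ˡ k) → neighbourSum G labelˡ p ≡ neighbourSum G labelˡ q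
  weight-↑ˡ-cancel {p} {q} eq = +-cancelʳ-≡ (∑ labelʳ) _ _ (trans (sym (weight-↑ˡ p)) (trans eq (weight-↑ˡ q)))

  weight-↑ʳ-cancel : ∀ {p q} → w (m ↑ʳ p) ≡ w (m ↑ʳ q) → neighbourSum H labelʳ p ≡ neighbourSum H labelʳ q
  weight-↑ʳ-cancel {p} {q} eq = +-cancelˡ-≡ (∑ labelˡ) _ _ (trans (sym (weight-↑ʳ p)) (trans eq (weight-↑ʳ q)))

  weight-↑ʳ-cong : ∀ {p q} → neighbourSum H labelʳ p ≡ neighbourSum H labelʳ q → w (m ↑ʳ p) ≡ w (m ↑ʳ q)
  weight-↑ʳ-cong {p} {q} eq = trans (weight-↑ʳ p) (trans (cong (∑ labelˡ +_) eq) (sym (weight-↑ʳ q)))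

  isLDA-join : ProperNeighbourSums G labelˡ → ProperNeighbourSums H labelʳ →
               (∀ p q → w (p ↑ˡ k) ≢ w (m ↑ʳ q)) → IsLDA (join G H) f
  isLDA-join properG properH ≢-across u v with splitView m u | splitView m v
  ... | left p  | left q  = λ e → properG p q (trans (sym (adj-join-↑ˡ-↑ˡ G H p q)) e) ∘ weight-↑ˡ-cancel
  ... | left p  | right q = λ _ → ≢-across p q
  ... | right p | left q  = λ _ → ≢-across q p ∘ sym
  ... | right p | right q = λ e → properH p q (trans (sym (adj-join-↑ʳ-↑ʳ G H p q)) e) ∘ weight-↑ʳ-cancel

module Friendship (n : ℕ) where

  u v : Fin n → Fin (suc (n + n))
  u j = suc (j ↑ˡ n)
  v j = suc (n ↑ʳ j)

  mate : Fin (n + n) → Fin (n + n)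
  mate i with splitView n i
  ... | left j  = n ↑ʳ j
  ... | right j = j ↑ˡ n

  mate-injective : ∀ {i i′} → mate i ≡ mate i′ → i ≡ i′
  mate-injective {i} {i′} eq with splitView n i | splitView n i′
  ... | left j  | left j′  = cong (_↑ˡ n) (↑ʳ-injective n j j′ eq)
  ... | left j  | right j′ = ⊥-elim (↑ˡ≢↑ʳ j′ j (sym eq))
  ... | right j | left j′  = ⊥-elim (↑ˡ≢↑ʳ j j′ eq)
  ... | right j | right j′ = cong (n ↑ʳ_) (↑ˡ-injective n j j′ eq)

  private
    F = friendship n

  adj-u-u : ∀ j k → adj F (u j) (u k) ≡ false
  adj-u-u j k rewrite splitAt-↑ˡ n j n | splitAt-↑ˡ n k n = refl

  adj-u-v : ∀ j k → adj F (u j) (v k) ≡ ⌊ j ≟ᶠ k ⌋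
  adj-u-v j k rewrite splitAt-↑ˡ n j n | splitAt-↑ʳ n n k = refl

  adj-v-u : ∀ j k → adj F (v j) (u k) ≡ ⌊ j ≟ᶠ k ⌋
  adj-v-u j k rewrite splitAt-↑ʳ n n j | splitAt-↑ˡ n k n = refl

  adj-v-v : ∀ j k → adj F (v j) (v k) ≡ false
  adj-v-v j k rewrite splitAt-↑ʳ n n j | splitAt-↑ʳ n n k = refl

  loopless : ∀ p → adj F p p ≡ false
  loopless zero = refl
  loopless (suc i) with splitView n i
  ... | left j  = adj-u-u j j
  ... | right j = adj-v-v j j

  module _ (g : Fin (suc (n + n)) → ℕ) where

    private
      row : Fin (suc (n + n)) → Fin (suc (n + n)) → ℕ
      row p x = if adj F p x then g x else 0

    neighbourSum-centre : neighbourSum F g zero ≡ ∑ (g ∘ u) + ∑ (g ∘ v)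
    neighbourSum-centre = ∑-↑ˡ-↑ʳ n (g ∘ suc)

    neighbourSum-u : ∀ j → neighbourSum F g (u j) ≡ g zero + g (v j)
    neighbourSum-u j = cong (g zero +_) (begin
      ∑ (row (u j) ∘ suc)
        ≡⟨ ∑-↑ˡ-↑ʳ n (row (u j) ∘ suc) ⟩
      ∑ (row (u j) ∘ u) + ∑ (row (u j) ∘ v)
        ≡⟨ cong₂ _+_ (∑-zero λ k → cong (if_then g (u k) else 0) (adj-u-u j k))
                     (sum-cong-≗ λ k → cong (if_then g (v k) else 0) (adj-u-v j k)) ⟩
      ∑ (λ k → if ⌊ j ≟ᶠ k ⌋ then g (v k) else 0)
        ≡⟨ ∑-indicator j (g ∘ v) ⟩
      g (v j)
        ∎)
      where open ≡-Reasoning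

    neighbourSum-v : ∀ j → neighbourSum F g (v j) ≡ g zero + g (u j)
    neighbourSum-v j = cong (g zero +_) (begin
      ∑ (row (v j) ∘ suc)
        ≡⟨ ∑-↑ˡ-↑ʳ n (row (v j) ∘ suc) ⟩
      ∑ (row (v j) ∘ u) + ∑ (row (v j) ∘ v)
        ≡⟨ cong₂ _+_ (sum-cong-≗ λ k → cong (if_then g (u k) else 0) (adj-v-u j k))
                     (∑-zero λ k → cong (if_then g (v k) else 0) (adj-v-v j k)) ⟩
      ∑ (λ k → if ⌊ j ≟ᶠ k ⌋ then g (u k) else 0) + 0
        ≡⟨ trans (+-identityʳ _) (∑-indicator j (g ∘ u)) ⟩
      g (u j)
        ∎)
      where open ≡-Reasoning

    neighbourSum-leaf : ∀ i → neighbourSum F g (suc i) ≡ g zero + g (suc (mate i))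
    neighbourSum-leaf i with splitView n i
    ... | left j  = neighbourSum-u j
    ... | right j = neighbourSum-v j

    u+v≤∑ : ∀ j → g (u j) + g (v j) ≤ ∑ (g ∘ suc)
    u+v≤∑ j = subst (g (u j) + g (v j) ≤_) (sym neighbourSum-centre) (+-mono-≤ (≤-∑ (g ∘ u) j) (≤-∑ (g ∘ v) j))

    leaf+mate≤∑ : ∀ i → g (suc i) + g (suc (mate i)) ≤ ∑ (g ∘ suc)
    leaf+mate≤∑ i with splitView n i
    ... | left j  = u+v≤∑ j
    ... | right j = subst (_≤ ∑ (g ∘ suc)) (+-comm (g (u j)) (g (v j))) (u+v≤∑ j)

    leaf<centre : ∀ i → g zero < g (suc i) → neighbourSum F g (suc i) < neighbourSum F g zero
    leaf<centre i centre<leaf = begin-strict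
      neighbourSum F g (suc i)      ≡⟨ neighbourSum-leaf i ⟩
      g zero + g (suc (mate i))     <⟨ +-monoˡ-< (g (suc (mate i))) centre<leaf ⟩
      g (suc i) + g (suc (mate i))  ≤⟨ leaf+mate≤∑ i ⟩
      ∑ (g ∘ suc)                   ∎
      where open ≤-Reasoning

    neighbourSum-leaf-injective : (∀ {p q} → g p ≡ g q → p ≡ q) →
      ∀ {i i′} → neighbourSum F g (suc i) ≡ neighbourSum F g (suc i′) → i ≡ i′
    neighbourSum-leaf-injective g-injective {i} {i′} eq =
      mate-injective (suc-injectiveᶠ (g-injective (+-cancelˡ-≡ (g zero) _ _
        (trans (sym (neighbourSum-leaf i)) (trans eq (neighbourSum-leaf i′))))))

    proper : (∀ {p q} → g p ≡ g q → p ≡ q) → (∀ i → g zero < g (suc i)) → ProperNeighbourSums F g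
    proper g-injective centre< zero    zero    ()
    proper g-injective centre< zero    (suc i) _ = ≢-sym (<⇒≢ (leaf<centre i (centre< i)))
    proper g-injective centre< (suc i) zero    _ = <⇒≢ (leaf<centre i (centre< i))
    proper g-injective centre< (suc i) (suc i′) adjacent eq
      with refl ← neighbourSum-leaf-injective g-injective eq
      with () ← trans (sym adjacent) (loopless (suc i))

    0<neighbourSum : (∀ p → 0 < g p) → Fin n → ∀ p → 0 < neighbourSum F g p
    0<neighbourSum positive j zero    = <-≤-trans (positive (u j)) (≤-∑ (g ∘ suc) (j ↑ˡ n))
    0<neighbourSum positive j (suc i) = <-≤-trans (positive zero) (m≤m+n (g zero) _)

module Bistar (n : ℕ) where

  a b : Fin (suc (suc (n + n)))
  a = zero
  b = suc zero

  x y : Fin n → Fin (suc (suc (n + n)))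
  x j = suc (suc (j ↑ˡ n))
  y j = suc (suc (n ↑ʳ j))

  data View : Fin (suc (suc (n + n))) → Set where
    at-a : View a
    at-b : View b
    at-x : ∀ j → View (x j)
    at-y : ∀ j → View (y j)

  view : ∀ q → View q
  view zero          = at-a
  view (suc zero)    = at-b
  view (suc (suc i)) with splitView n i
  ... | left j  = at-x j
  ... | right j = at-y j

  private
    B = bistar n

  adj-a-x : ∀ j → adj B a (x j) ≡ true
  adj-a-x j rewrite splitAt-↑ˡ n j n = refl

  adj-x-a : ∀ j → adj B (x j) a ≡ true
  adj-x-a j rewrite splitAt-↑ˡ n j n = refl

  adj-a-y : ∀ j → adj B a (y j) ≡ false
  adj-a-y j rewrite splitAt-↑ʳ n n j = refl

  adj-y-a : ∀ j → adj B (y j) a ≡ false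
  adj-y-a j rewrite splitAt-↑ʳ n n j = refl

  adj-b-x : ∀ j → adj B b (x j) ≡ false
  adj-b-x j rewrite splitAt-↑ˡ n j n = refl

  adj-x-b : ∀ j → adj B (x j) b ≡ false
  adj-x-b j rewrite splitAt-↑ˡ n j n = refl

  adj-b-y : ∀ j → adj B b (y j) ≡ true
  adj-b-y j rewrite splitAt-↑ʳ n n j = refl

  adj-y-b : ∀ j → adj B (y j) b ≡ true
  adj-y-b j rewrite splitAt-↑ʳ n n j = refl

  data Edge : Fin (suc (suc (n + n))) → Fin (suc (suc (n + n))) → Set where
    a-b : Edge a b
    a-x : ∀ j → Edge a (x j)
    b-y : ∀ j → Edge b (y j)

  edge : ∀ {p q} → View p → View q → adj B p q ≡ true → Edge p q ⊎ Edge q p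
  edge at-a     at-b     _ = inj₁ a-b
  edge at-a     (at-x j) _ = inj₁ (a-x j)
  edge at-b     at-a     _ = inj₂ a-b
  edge at-b     (at-y j) _ = inj₁ (b-y j)
  edge (at-x j) at-a     _ = inj₂ (a-x j)
  edge (at-y j) at-b     _ = inj₂ (b-y j)
  edge at-a     (at-y j) e with () ← trans (sym e) (adj-a-y j)
  edge at-b     (at-x j) e with () ← trans (sym e) (adj-b-x j)
  edge (at-x j) at-b     e with () ← trans (sym e) (adj-x-b j)
  edge (at-y j) at-a     e with () ← trans (sym e) (adj-y-a j)

  module _ (g : Fin (suc (suc (n + n))) → ℕ) where

    private
      row : Fin (suc (suc (n + n))) → Fin (suc (suc (n + n))) → ℕ
      row p q = if adj B p q then g q else 0

      leafSum : Fin (suc (suc (n + n))) → ℕ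
      leafSum p = ∑ λ i → row p (suc (suc i))

      leafSum-split : ∀ p → leafSum p ≡ ∑ (row p ∘ x) + ∑ (row p ∘ y)
      leafSum-split p = ∑-↑ˡ-↑ʳ n λ i → row p (suc (suc i))

    neighbourSum-a : neighbourSum B g a ≡ g b + ∑ (g ∘ x)
    neighbourSum-a = cong (g b +_) (begin
      leafSum a                          ≡⟨ leafSum-split a ⟩
      ∑ (row a ∘ x) + ∑ (row a ∘ y)      ≡⟨ cong₂ _+_ (sum-cong-≗ λ j → cong (if_then g (x j) else 0) (adj-a-x j))
                                                      (∑-zero λ j → cong (if_then g (y j) else 0) (adj-a-y j)) ⟩
      ∑ (g ∘ x) + 0                      ≡⟨ +-identityʳ _ ⟩
      ∑ (g ∘ x)                          ∎)
      where open ≡-Reasoning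

    neighbourSum-b : neighbourSum B g b ≡ g a + ∑ (g ∘ y)
    neighbourSum-b = cong (g a +_) (begin
      leafSum b                          ≡⟨ leafSum-split b ⟩
      ∑ (row b ∘ x) + ∑ (row b ∘ y)      ≡⟨ cong₂ _+_ (∑-zero λ j → cong (if_then g (x j) else 0) (adj-b-x j))
                                                      (sum-cong-≗ λ j → cong (if_then g (y j) else 0) (adj-b-y j)) ⟩
      ∑ (g ∘ y)                          ∎)
      where open ≡-Reasoning

    neighbourSum-x : ∀ j → neighbourSum B g (x j) ≡ g a
    neighbourSum-x j = begin
      row (x j) a + (row (x j) b + leafSum (x j))  ≡⟨ cong₂ _+_ (cong (if_then g a else 0) (adj-x-a j))
                                                       (cong₂ _+_ (cong (if_then g b else 0) (adj-x-b j)) (∑-zero {n + n} λ _ → refl)) ⟩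
      g a + 0                                      ≡⟨ +-identityʳ (g a) ⟩
      g a                                          ∎
      where open ≡-Reasoning

    neighbourSum-y : ∀ j → neighbourSum B g (y j) ≡ g b
    neighbourSum-y j = cong₂ _+_ (cong (if_then g a else 0) (adj-y-a j))
                                 (trans (cong₂ _+_ (cong (if_then g b else 0) (adj-y-b j)) (∑-zero {n + n} λ _ → refl)) (+-identityʳ (g b)))

    ∑≡neighbourSum-a+neighbourSum-b : ∑ g ≡ neighbourSum B g a + neighbourSum B g b
    ∑≡neighbourSum-a+neighbourSum-b = begin
      ∑ g                                    ≡⟨ cong (λ s → g a + (g b + s)) (∑-↑ˡ-↑ʳ n λ i → g (suc (suc i))) ⟩
      g a + (g b + (∑ (g ∘ x) + ∑ (g ∘ y)))  ≡⟨ rearrange (g a) (g b) (∑ (g ∘ x)) (∑ (g ∘ y)) ⟩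
      (g b + ∑ (g ∘ x)) + (g a + ∑ (g ∘ y))  ≡⟨ cong₂ _+_ neighbourSum-a neighbourSum-b ⟨
      neighbourSum B g a + neighbourSum B g b  ∎
      where
      open ≡-Reasoning
      rearrange : ∀ s t X Y → s + (t + (X + Y)) ≡ (t + X) + (s + Y)
      rearrange = solve-∀

    neighbourSum≤neighbourSum-b : g b ≤ g a → ∑ (g ∘ x) ≤ ∑ (g ∘ y) →
                                  ∀ q → neighbourSum B g q ≤ neighbourSum B g b
    neighbourSum≤neighbourSum-b b≤a X≤Y q = subst (neighbourSum B g q ≤_) (sym neighbourSum-b) (bound (view q))
      where
      bound : ∀ {q} → View q → neighbourSum B g q ≤ g a + ∑ (g ∘ y)
      bound at-a     = subst (_≤ g a + ∑ (g ∘ y)) (sym neighbourSum-a) (+-mono-≤ b≤a X≤Y)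
      bound at-b     = ≤-reflexive neighbourSum-b
      bound (at-x j) = subst (_≤ g a + ∑ (g ∘ y)) (sym (neighbourSum-x j)) (m≤m+n (g a) _)
      bound (at-y j) = subst (_≤ g a + ∑ (g ∘ y)) (sym (neighbourSum-y j)) (≤-trans b≤a (m≤m+n (g a) _))

    proper : g b < g a → (∀ j → g a < g (x j)) → ∑ (g ∘ x) ≤ ∑ (g ∘ y) → ProperNeighbourSums B g
    proper b<a a<x X≤Y p q adjacent = [ separated , ≢-sym ∘ separated ] (edge (view p) (view q) adjacent)
      where
      open ≤-Reasoning
      separated : ∀ {p q} → Edge p q → neighbourSum B g p ≢ neighbourSum B g q
      separated a-b     = <⇒≢ $ begin-strict
        neighbourSum B g a     ≡⟨ neighbourSum-a ⟩
        g b + ∑ (g ∘ x)        <⟨ +-mono-<-≤ b<a X≤Y ⟩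
        g a + ∑ (g ∘ y)        ≡⟨ neighbourSum-b ⟨
        neighbourSum B g b     ∎
      separated (a-x j) = ≢-sym ∘ <⇒≢ $ begin-strict
        neighbourSum B g (x j) ≡⟨ neighbourSum-x j ⟩
        g a                    <⟨ a<x j ⟩
        g (x j)                ≤⟨ ≤-∑ (g ∘ x) j ⟩
        ∑ (g ∘ x)              ≤⟨ m≤n+m _ (g b) ⟩
        g b + ∑ (g ∘ x)        ≡⟨ neighbourSum-a ⟨
        neighbourSum B g a     ∎
      separated (b-y j) = ≢-sym ∘ <⇒≢ $ begin-strict
        neighbourSum B g (y j) ≡⟨ neighbourSum-y j ⟩
        g b                    <⟨ b<a ⟩
        g a                    ≤⟨ m≤m+n (g a) _ ⟩
        g a + ∑ (g ∘ y)        ≡⟨ neighbourSum-b ⟨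
        neighbourSum B g b     ∎

    module _ (positive : ∀ q → 0 < g q) where

      neighbourSum-a≢y : ∀ j → neighbourSum B g a ≢ neighbourSum B g (y j)
      neighbourSum-a≢y j = ≢-sym ∘ <⇒≢ $ begin-strict
        neighbourSum B g (y j) ≡⟨ neighbourSum-y j ⟩
        g b                    <⟨ m<m+n (g b) (<-≤-trans (positive (x j)) (≤-∑ (g ∘ x) j)) ⟩
        g b + ∑ (g ∘ x)        ≡⟨ neighbourSum-a ⟨
        neighbourSum B g a     ∎
        where open ≤-Reasoning

      neighbourSum-b≢x : ∀ j → neighbourSum B g b ≢ neighbourSum B g (x j)
      neighbourSum-b≢x j = ≢-sym ∘ <⇒≢ $ begin-strict
        neighbourSum B g (x j) ≡⟨ neighbourSum-x j ⟩
        g a                    <⟨ m<m+n (g a) (<-≤-trans (positive (y j)) (≤-∑ (g ∘ y) j)) ⟩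
        g a + ∑ (g ∘ y)        ≡⟨ neighbourSum-b ⟨
        neighbourSum B g b     ∎
        where open ≤-Reasoning

    neighbourSum-x≢y : g a ≢ g b → ∀ j k → neighbourSum B g (x j) ≢ neighbourSum B g (y k)
    neighbourSum-x≢y a≢b j k eq = a≢b (trans (sym (neighbourSum-x j)) (trans eq (neighbourSum-y k)))

module FriendshipJoinBistar (n : ℕ) where

  open Friendship n using (u; v; neighbourSum-centre; neighbourSum-leaf-injective)
  open Bistar n using (a; b; x; y; at-a; at-b; at-x; at-y; adj-a-x; adj-b-y)

  private
    F = friendship n
    B = bistar n
    G = join F B

  inF : Fin (order F) → Fin (order G)
  inF p = p ↑ˡ order B

  inB : Fin (order B) → Fin (order G)
  inB q = order F ↑ʳ q

  module Weights (f : Labeling G) where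

    open JoinLabeling F B f public

    weight-x : ∀ j k → w (inB (x j)) ≡ w (inB (x k))
    weight-x j k = weight-↑ʳ-cong (trans (Bistar.neighbourSum-x n labelʳ j) (sym (Bistar.neighbourSum-x n labelʳ k)))

    weight-y : ∀ j k → w (inB (y j)) ≡ w (inB (y k))
    weight-y j k = weight-↑ʳ-cong (trans (Bistar.neighbourSum-y n labelʳ j) (sym (Bistar.neighbourSum-y n labelʳ k)))

    module _ (isLDA : IsLDA G f) where

      weight-inF-injective : ∀ {p p′} → w (inF p) ≡ w (inF p′) → p ≡ p′
      weight-inF-injective {zero}  {zero}   _  = refl
      weight-inF-injective {zero}  {suc i}  eq = ⊥-elim (isLDA (inF zero) (inF (suc i)) (adj-join-↑ˡ-↑ˡ F B zero (suc i)) eq)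
      weight-inF-injective {suc i} {zero}   eq = ⊥-elim (isLDA (inF (suc i)) (inF zero) (adj-join-↑ˡ-↑ˡ F B (suc i) zero) eq)
      weight-inF-injective {suc i} {suc i′} eq =
        cong suc (neighbourSum-leaf-injective labelˡ labelˡ-injective (weight-↑ˡ-cancel {suc i} {suc i′} eq))

      representatives : Fin n → List (Fin (order G))
      representatives j = inB a ∷ inB b ∷ inB (x j) ∷ inB (y j) ∷ tabulate inF

      representatives-distinct : ∀ j → AllPairs (λ z z′ → w z ≢ w z′) (representatives j)
      representatives-distinct j =
          (isLDA (inB a) (inB b) (adj-join-↑ʳ-↑ʳ F B a b)
           ∷ isLDA (inB a) (inB (x j)) (trans (adj-join-↑ʳ-↑ʳ F B a (x j)) (adj-a-x j))
           ∷ Bistar.neighbourSum-a≢y n labelʳ 0<labelʳ j ∘ weight-↑ʳ-cancel {a} {y j}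
           ∷ acrossFrom a)
        ∷ (Bistar.neighbourSum-b≢x n labelʳ 0<labelʳ j ∘ weight-↑ʳ-cancel {b} {x j}
           ∷ isLDA (inB b) (inB (y j)) (trans (adj-join-↑ʳ-↑ʳ F B b (y j)) (adj-b-y j))
           ∷ acrossFrom b)
        ∷ (Bistar.neighbourSum-x≢y n labelʳ a≢b j j ∘ weight-↑ʳ-cancel {x j} {y j} ∷ acrossFrom (x j))
        ∷ acrossFrom (y j)
        ∷ AllPairs.tabulate⁺ {f = inF} (λ p≢p′ → p≢p′ ∘ weight-inF-injective)
        where
        acrossFrom : ∀ q → All (λ z → w (inB q) ≢ w z) (tabulate inF)
        acrossFrom q = All.tabulate⁺ {f = inF} λ p → isLDA (inB q) (inF p) (adj-join-↑ʳ-↑ˡ F B q p)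
        a≢b : labelʳ a ≢ labelʳ b
        a≢b eq with () ← labelʳ-injective {a} {b} eq

      representatives-attain : ∀ j z → w z ∈ map w (representatives j)
      representatives-attain j z with splitView (order F) z
      ... | left p  = there (there (there (there (∈-map⁺ w (∈-tabulate⁺ {f = inF} p)))))
      ... | right q with Bistar.view n q
      ...   | at-a   = here refl
      ...   | at-b   = there (here refl)
      ...   | at-x k = there (there (here (weight-x k j)))
      ...   | at-y k = there (there (there (here (weight-y k j))))

      numWeights-LDA : Fin n → numWeights G f ≡ 2 * n + 5
      numWeights-LDA j = begin
        numWeights G f                    ≡⟨ numWeights≡length G f (representatives j)
                                               (representatives-distinct j) (representatives-attain j) ⟩
        4 + length (tabulate inF)         ≡⟨ cong (4 +_) (length-tabulate inF) ⟩
        4 + suc (n + n)                   ≡⟨ regroup n ⟩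
        2 * n + 5                         ∎
        where
        open ≡-Reasoning
        regroup : ∀ n → 4 + suc (n + n) ≡ 2 * n + 5
        regroup = solve-∀

    isLDA-ordered : Fin n →
      (∀ i → labelˡ zero < labelˡ (suc i)) →
      labelʳ b < labelʳ a → (∀ j → labelʳ a < labelʳ (x j)) → ∑ (labelʳ ∘ x) ≤ ∑ (labelʳ ∘ y) →
      ∑ labelˡ ≤ labelʳ b + ∑ (labelʳ ∘ x) →
      IsLDA G f
    isLDA-ordered j centre<leaf b<a a<x X≤Y ∑ˡ≤ =
      isLDA-join (Friendship.proper n labelˡ labelˡ-injective centre<leaf)
                 (Bistar.proper n labelʳ b<a a<x X≤Y)
                 (λ p q → ≢-sym (<⇒≢ (inB<inF p q)))
      where
      open ≤-Reasoning
      inB<inF : ∀ p q → w (inB q) < w (inF p)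
      inB<inF p q = begin-strict
        w (inB q)
          ≡⟨ weight-↑ʳ q ⟩
        ∑ labelˡ + neighbourSum B labelʳ q
          ≤⟨ +-mono-≤ ∑ˡ≤ (Bistar.neighbourSum≤neighbourSum-b n labelʳ (<⇒≤ b<a) X≤Y q) ⟩
        (labelʳ b + ∑ (labelʳ ∘ x)) + neighbourSum B labelʳ b
          ≡⟨ cong (_+ neighbourSum B labelʳ b) (Bistar.neighbourSum-a n labelʳ) ⟨
        neighbourSum B labelʳ a + neighbourSum B labelʳ b
          ≡⟨ Bistar.∑≡neighbourSum-a+neighbourSum-b n labelʳ ⟨
        ∑ labelʳ
          <⟨ m<n+m (∑ labelʳ) (Friendship.0<neighbourSum n labelˡ 0<labelˡ j p) ⟩
        neighbourSum F labelˡ p + ∑ labelʳ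
          ≡⟨ weight-↑ˡ p ⟨
        w (inF p)
          ∎

  -- Without the swap of a and b, n = 1 would give w(a) = w(b).
  swapAB : Labeling G
  swapAB = ↔⇒⤖ (transpose (inB a) (inB b))

  module _ where

    open Weights swapAB

    private
      inB-injective : ∀ {q q′} → inB q ≡ inB q′ → q ≡ q′
      inB-injective = ↑ʳ-injective (order F) _ _

      labelˡ≡ : ∀ p → labelˡ p ≡ suc (toℕ p)
      labelˡ≡ p = cong suc (begin
        toℕ (PC.transpose (inB a) (inB b) (inF p))  ≡⟨ cong toℕ (transpose-≢ (↑ˡ≢↑ʳ p a) (↑ˡ≢↑ʳ p b)) ⟩
        toℕ (inF p)                                 ≡⟨ toℕ-↑ˡ p (order B) ⟩
        toℕ p                                       ∎)
        where open ≡-Reasoning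

      labelʳ-a : labelʳ a ≡ suc (order F + 1)
      labelʳ-a = cong suc (trans (cong toℕ (transpose-i≡j {i = inB a})) (toℕ-↑ʳ (order F) b))

      labelʳ-b : labelʳ b ≡ suc (order F + 0)
      labelʳ-b = cong suc (trans (cong toℕ (transpose-j≡i λ eq → case inB-injective eq of λ ())) (toℕ-↑ʳ (order F) a))

      labelʳ-leaf : ∀ i → labelʳ (suc (suc i)) ≡ suc (order F + suc (suc (toℕ i)))
      labelʳ-leaf i = cong suc (begin
        toℕ (PC.transpose (inB a) (inB b) (inB (suc (suc i))))
          ≡⟨ cong toℕ (transpose-≢ (λ eq → case inB-injective eq of λ ()) (λ eq → case inB-injective eq of λ ())) ⟩
        toℕ (inB (suc (suc i)))
          ≡⟨ toℕ-↑ʳ (order F) (suc (suc i)) ⟩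
        order F + suc (suc (toℕ i))
          ∎)
        where open ≡-Reasoning

      centre<leaf : ∀ i → labelˡ zero < labelˡ (suc i)
      centre<leaf i rewrite labelˡ≡ zero | labelˡ≡ (suc i) = s≤s (s≤s z≤n)

      b<a : labelʳ b < labelʳ a
      b<a rewrite labelʳ-a | labelʳ-b = s≤s (+-monoʳ-< (order F) (s≤s z≤n))

      a<x : ∀ j → labelʳ a < labelʳ (x j)
      a<x j rewrite labelʳ-a | labelʳ-leaf (j ↑ˡ n) = s≤s (+-monoʳ-< (order F) (s≤s (s≤s z≤n)))

      X≤Y : ∑ (labelʳ ∘ x) ≤ ∑ (labelʳ ∘ y)
      X≤Y = ∑-mono-≤ x≤y
        where
        x≤y : ∀ j → labelʳ (x j) ≤ labelʳ (y j)
        x≤y j rewrite labelʳ-leaf (j ↑ˡ n) | labelʳ-leaf (n ↑ʳ j) | toℕ-↑ˡ j n | toℕ-↑ʳ n j =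
          s≤s (+-monoʳ-≤ (order F) (s≤s (s≤s (m≤n+m (toℕ j) n))))

      ∑ˡ≤ : ∑ labelˡ ≤ labelʳ b + ∑ (labelʳ ∘ x)
      ∑ˡ≤ = +-mono-≤ centre≤b (begin
        ∑ (labelˡ ∘ suc)                          ≡⟨ neighbourSum-centre labelˡ ⟩
        ∑ (labelˡ ∘ u) + ∑ (labelˡ ∘ v)           ≡⟨ ∑-distrib-+ (labelˡ ∘ u) (labelˡ ∘ v) ⟨
        ∑ (λ j → labelˡ (u j) + labelˡ (v j))     ≤⟨ ∑-mono-≤ u+v≤x ⟩
        ∑ (labelʳ ∘ x)                            ∎)
        where
        open ≤-Reasoning
        centre≤b : labelˡ zero ≤ labelʳ b
        centre≤b rewrite labelˡ≡ zero | labelʳ-b = s≤s z≤n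
        u+v≤x : ∀ j → labelˡ (u j) + labelˡ (v j) ≤ labelʳ (x j)
        u+v≤x j = begin
          labelˡ (u j) + labelˡ (v j)           ≡⟨ cong₂ _+_ (labelˡ≡ (u j)) (labelˡ≡ (v j)) ⟩
          suc (toℕ (u j)) + suc (toℕ (v j))     ≡⟨ cong₂ _+_ (cong (2 +_) (toℕ-↑ˡ j n)) (cong (2 +_) (toℕ-↑ʳ n j)) ⟩
          (2 + t) + (2 + (n + t))               ≡⟨ regroupˡ n t ⟩
          (4 + n + t) + t                       ≤⟨ +-monoʳ-≤ (4 + n + t) (<⇒≤ (toℕ<n j)) ⟩
          (4 + n + t) + n                       ≡⟨ regroupʳ n t ⟩
          suc (order F + suc (suc t))           ≡⟨ cong (λ s → suc (order F + suc (suc s))) (toℕ-↑ˡ j n) ⟨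
          suc (order F + suc (suc (toℕ (j ↑ˡ n)))) ≡⟨ labelʳ-leaf (j ↑ˡ n) ⟨
          labelʳ (x j)                          ∎
          where
          t = toℕ j
          regroupˡ : ∀ n t → (2 + t) + (2 + (n + t)) ≡ (4 + n + t) + t
          regroupˡ = solve-∀
          regroupʳ : ∀ n t → (4 + n + t) + n ≡ suc (suc (n + n) + suc (suc t))
          regroupʳ = solve-∀

    isLDA-swapAB : Fin n → IsLDA G swapAB
    isLDA-swapAB j = isLDA-ordered j centre<leaf b<a a<x X≤Y ∑ˡ≤

mainTheorem4 : (n : ℕ) → 1 ≤ n →
    ChiLd≡ (join (friendship n) (bistar n)) (2 * n + 5)
mainTheorem4 n 1≤n =
  (swapAB , isLDA-swapAB j , numWeights-LDA swapAB (isLDA-swapAB j) j) ,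
  λ f isLDA → ≤-reflexive (sym (numWeights-LDA f isLDA j))
  where
  open FriendshipJoinBistar n
  open Weights using (numWeights-LDA)
  j : Fin n
  j = fromℕ< 1≤n
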